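{- Let $p$ be a prime, let $a,b\in\mathbb{Z}$ with $a>0$ and $\gcd(a,b)=1$, and let $k\in\mathbb{Z}$ with $k>-\operatorname{ord}_p(a/b)$. Set $r_{ -1}=a$ and, for $i\ge 0$ while $r_{i-1}\neq 0$, let $q_i,r_i\in\mathbb{Z}[\tfrac1p]$ be the unique elements with $$bq_0q_1\cdots q_{i-1}=r_{i-1}q_i-r_i,\qquad 0\le r_i<r_{i-1}p^k,\qquad |r_i|_p\le |r_{i-1}p^k|_p$$ (for $i=0$ the left side is $b$), stopping when some $r_N=0$. Then this process terminates after finitely many steps, i.e. $r_N=0$ for some $N$.
   Context: $\operatorname{ord}_p$ is the $p$-adic valuation and $|\cdot|_p$ the $p$-adic absolute value ($|x|_p=p^{ -\operatorname{ord}_p(x)}$, $|0|_p=0$). For $a'\in\mathbb{Z}[\tfrac1p]$ with $a'>0$ and $b'\in\mathbb{Z}[\tfrac1p]$, there are unique $q,r\in\mathbb{Z}[\tfrac1p]$ with $b'=a'q-r$, $0\le r<a'p^k$, $|r|_p\le|a'p^k|_p$ (the "$p^k$-division algorithm"); each step above applies it with divisor $r_{i-1}>0$ and dividend $bq_0\cdots q_{i-1}$. This process is called the $p^k$-Greedy Algorithm on $a/b$. -}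

module Defs where

open import Data.Nat as ℕ using (ℕ; zero; suc)
open import Data.Nat.Properties using (m^n≢0)
open import Data.Nat.Divisibility using (_∣_)
open import Data.Nat.Primality using (Prime; prime⇒nonZero)
open import Data.Integer as ℤ using (ℤ; +_; -[1+_]; +[1+_]; ∣_∣)
open import Data.Rational as ℚ using (ℚ; _/_; 0ℚ; 1ℚ; _*_; _≤_)
open import Data.Product using (Σ; _×_)
open import Data.Sum using (_⊎_)
open import Relation.Nullary using (¬_)
open import Relation.Binary.PropositionalEquality using (_≡_)

fromℤ : ℤ → ℚ
fromℤ z = z / 1

powZ : (p : ℕ) → Prime p → ℤ → ℚ
powZ p pp (+ n) = fromℤ (+ (p ℕ.^ n))
powZ p pp -[1+ n ] = (+ 1) / (p ℕ.^ suc n)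
  where instance
    _ = prime⇒nonZero pp
    _ = m^n≢0 p (suc n) {{prime⇒nonZero pp}}

-- the rational number a / b for integers a, b (junk value 0 when b = 0)
_/ℤ_ : ℤ → ℤ → ℚ
a /ℤ (+ zero) = 0ℚ
a /ℤ +[1+ n ] = a / suc n
a /ℤ -[1+ n ] = (ℤ.- a) / suc n

InZ1p : ℕ → ℚ → Set
InZ1p p x = Σ ℕ λ e → Σ ℤ λ m → x * fromℤ (+ (p ℕ.^ e)) ≡ fromℤ m

-- ord_p x ≡ v  (x = p^v · u/w with p ∤ u, p ∤ w; forces x ≠ 0)
HasOrd : (p : ℕ) → Prime p → ℚ → ℤ → Set
HasOrd p pp x v = Σ ℤ λ u → Σ ℕ λ w →
  ¬ (p ∣ ∣ u ∣) × ¬ (p ∣ suc w) × x ≡ powZ p pp v * (u / suc w)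

AbsLe : (p : ℕ) → Prime p → ℚ → ℚ → Set
AbsLe p pp x y = x ≡ 0ℚ ⊎
  Σ ℤ λ vx → Σ ℤ λ vy → HasOrd p pp x vx × HasOrd p pp y vy × vy ℤ.≤ vx

prodUpTo : (ℕ → ℚ) → ℕ → ℚ
prodUpTo q zero = 1ℚ
prodUpTo q (suc i) = prodUpTo q i * q i

-- r_{i-1}, with r_{-1} = a ; here rPrev a r i = r_{i-1}
rPrev : ℤ → (ℕ → ℚ) → ℕ → ℚ
rPrev a r zero = fromℤ a
rPrev a r (suc i) = r i

GreedyStep : (p : ℕ) → Prime p → ℤ → ℤ → ℤ → (ℕ → ℚ) → (ℕ → ℚ) → ℕ → Set
GreedyStep p pp k a b q r i =
  InZ1p p (q i) × InZ1p p (r i) ×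
  fromℤ b * prodUpTo q i ≡ rPrev a r i * q i ℚ.- r i ×
  0ℚ ≤ r i × r i ℚ.< rPrev a r i * powZ p pp k ×
  AbsLe p pp (r i) (rPrev a r i * powZ p pp k)

module Submission where

-- Every nonzero element x ≥ 0 of ℤ[1/p] is uniquely p^e · n with n a
-- positive integer prime to p; call n the unit part of x.  The defining
-- conditions of a greedy step say that r_i < r_{i-1} p^k and that
-- ord_p r_i ≥ ord_p (r_{i-1} p^k).  Since r_{i-1} p^k has the same unit part
-- as r_{i-1}, comparing p^{e'} m < p^e n with e' ≥ e forces m < n: the unit
-- parts of the nonzero remainders form a strictly decreasing sequence of
-- natural numbers, so some remainder must vanish.

open import Defs
open import Data.Nat using (ℕ; _<_)
open import Data.Nat.Primality using (Prime)
open import Data.Integer as ℤ using (ℤ; +_)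
open import Data.Integer.GCD using (gcd)
open import Data.Rational using (ℚ; 0ℚ)
open import Data.Product using (Σ)
open import Relation.Binary.PropositionalEquality using (_≡_; _≢_)

open import Data.Nat as ℕ using (zero; suc; _^_; _≤_; z≤n; s≤s; NonZero)
import Data.Nat.Properties as ℕP
open import Data.Nat.Divisibility using (_∣_; divides; ∣-trans; m∣m*n)
open import Data.Nat.Coprimality using (Coprime; coprime-divisor)
open import Data.Nat.Primality using (prime⇒nonZero; prime⇒irreducible; euclidsLemma)
open import Data.Nat.Induction using (<-wellFounded)
open import Data.Nat.Tactic.RingSolver using (solve-∀)
open import Data.Integer using (-[1+_])
import Data.Integer.Properties as ℤP
import Data.Rational as ℚ
import Data.Rational.Properties as ℚP
open import Data.Rational.Unnormalised as ℚᵘ using (ℚᵘ; mkℚᵘ; 0ℚᵘ; _≃_; *≡*; *<*; *≤*)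
import Data.Rational.Unnormalised.Properties as ℚᵘP
open import Data.Product using (∃; ∃₂; _×_; _,_; proj₁; proj₂; map₂)
open import Data.Sum using (inj₁; inj₂)
open import Data.Empty using (⊥-elim)
open import Induction.WellFounded using (Acc; acc)
open import Relation.Nullary using (¬_; yes; no)
open import Relation.Unary using (Decidable)
open import Relation.Binary.PropositionalEquality using (refl; sym; trans; cong; cong₂; subst; subst₂; module ≡-Reasoning)

descent : (Z : ℕ → Set) → Decidable Z → (P : ℕ → ℕ → Set) →
  (¬ Z 0 → ∃ (P 0)) →
  (∀ i n → (∀ j → j < suc i → ¬ Z j) → P i n → ¬ Z (suc i) → ∃ λ m → m < n × P (suc i) m) →
  ∃ Z
descent Z Z? P start step with Z? 0
... | yes z0 = 0 , z0
... | no ¬z0 with start ¬z0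
... | n , P0n = go n (<-wellFounded n) 0 P0n (λ { zero _ → ¬z0 ; (suc j) (s≤s ()) })
  where
  go : ∀ n → Acc _<_ n → ∀ i → P i n → (∀ j → j < suc i → ¬ Z j) → ∃ Z
  go n (acc smaller) i Pin avoided with Z? (suc i)
  ... | yes z = suc i , z
  ... | no ¬z with step i n avoided Pin ¬z
  ... | m , m<n , Pm = go m (smaller m<n) (suc i) Pm avoided′
    where
    avoided′ : ∀ j → j < suc (suc i) → ¬ Z j
    avoided′ j (s≤s j≤i) with ℕP.m≤n⇒m<n∨m≡n j≤i
    ... | inj₁ j<i = avoided j j<i
    ... | inj₂ refl = ¬z

frac : ℤ → ℕ → ℚᵘ
frac i d = mkℚᵘ i (ℕ.pred d)

toℚᵘ-/ : ∀ i d .{{_ : NonZero d}} → ℚ.toℚᵘ (i ℚ./ d) ≃ frac i d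
toℚᵘ-/ i (suc d) = ℚP.toℚᵘ-fromℚᵘ (mkℚᵘ i d)

frac-≃⇒ : ∀ {i j} b d .{{_ : NonZero b}} .{{_ : NonZero d}} →
  frac i b ≃ frac j d → ℤ.∣ i ∣ ℕ.* d ≡ ℤ.∣ j ∣ ℕ.* b
frac-≃⇒ {i} {j} (suc b) (suc d) (*≡* eq) =
  trans (sym (ℤP.abs-* i (+ suc d))) (trans (cong ℤ.∣_∣ eq) (ℤP.abs-* j (+ suc b)))

frac-≃⇐ : ∀ {m n} b d .{{_ : NonZero b}} .{{_ : NonZero d}} →
  m ℕ.* d ≡ n ℕ.* b → frac (+ m) b ≃ frac (+ n) d
frac-≃⇐ {m} {n} (suc b) (suc d) eq =
  *≡* (trans (sym (ℤP.pos-* m (suc d))) (trans (cong +_ eq) (ℤP.pos-* n (suc b))))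

frac-<⇒ : ∀ {m n} b d .{{_ : NonZero b}} .{{_ : NonZero d}} →
  frac (+ m) b ℚᵘ.< frac (+ n) d → m ℕ.* d < n ℕ.* b
frac-<⇒ {m} {n} (suc b) (suc d) (*<* lt) =
  ℤP.drop‿+<+ (subst₂ ℤ._<_ (sym (ℤP.pos-* m (suc d))) (sym (ℤP.pos-* n (suc b))) lt)

frac-nonneg : ∀ i d .{{_ : NonZero d}} → 0ℚᵘ ℚᵘ.≤ frac i d → + 0 ℤ.≤ i
frac-nonneg i (suc d) (*≤* le) = subst (+ 0 ℤ.≤_) (ℤP.*-identityʳ i) le

frac-* : ∀ i b j d .{{_ : NonZero b}} .{{_ : NonZero d}} →
  frac i b ℚᵘ.* frac j d ≃ frac (i ℤ.* j) (b ℕ.* d)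
frac-* i (suc b) j (suc d) = ℚᵘP.≃-refl

-- An integer exponent v splits as v = up v − down v, at most one of them
-- nonzero, so that p^v = p^(up v) / p^(down v).
up : ℤ → ℕ
up (+ n) = n
up -[1+ n ] = 0

down : ℤ → ℕ
down (+ n) = 0
down -[1+ n ] = suc n

up-down-mono : ∀ {v w} → v ℤ.≤ w → up v ℕ.+ down w ≤ up w ℕ.+ down v
up-down-mono (ℤ.+≤+ m≤n) = ℕP.+-monoˡ-≤ 0 m≤n
up-down-mono ℤ.-≤+ = z≤n
up-down-mono (ℤ.-≤- n≤m) = s≤s n≤m

module _ (p : ℕ) (pp : Prime p) where
  instance
    p≢0 : NonZero p
    p≢0 = prime⇒nonZero pp

  p^≢0 : ∀ n → NonZero (p ^ n)
  p^≢0 n = ℕP.m^n≢0 p n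

  pow-split : ∀ a b m → p ^ (a ℕ.+ b) ℕ.* m ≡ p ^ a ℕ.* m ℕ.* p ^ b
  pow-split a b m = trans (cong (ℕ._* m) (ℕP.^-distribˡ-+-* p a b)) (swap (p ^ a) (p ^ b) m)
    where
    swap : ∀ x y z → x ℕ.* y ℕ.* z ≡ x ℕ.* z ℕ.* y
    swap = solve-∀

  ∤⇒coprime : ∀ {s} → ¬ p ∣ s → Coprime s p
  ∤⇒coprime p∤s (d∣s , d∣p) with prime⇒irreducible pp d∣p
  ... | inj₁ d≡1 = d≡1
  ... | inj₂ refl = ⊥-elim (p∤s d∣s)

  ∤-* : ∀ {m n} → ¬ p ∣ m → ¬ p ∣ n → ¬ p ∣ m ℕ.* n
  ∤-* {m} {n} p∤m p∤n p∣mn with euclidsLemma m n pp p∣mn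
  ... | inj₁ p∣m = p∤m p∣m
  ... | inj₂ p∣n = p∤n p∣n

  coprime-pow-divisor : ∀ {s u} E → ¬ p ∣ s → s ∣ p ^ E ℕ.* u → s ∣ u
  coprime-pow-divisor {s} {u} zero _ s∣u = subst (s ∣_) (ℕP.*-identityˡ u) s∣u
  coprime-pow-divisor {s} {u} (suc E) p∤s s∣pᴱ⁺¹u = coprime-pow-divisor E p∤s
    (coprime-divisor (∤⇒coprime p∤s) (subst (s ∣_) (ℕP.*-assoc p (p ^ E) u) s∣pᴱ⁺¹u))

  p∣p^[1+X]* : ∀ X α → p ∣ p ^ suc X ℕ.* α
  p∣p^[1+X]* X α = ∣-trans (m∣m*n (p ^ X)) (m∣m*n α)

  pow-exponent-unique : ∀ X Y {α β} → p ^ X ℕ.* α ≡ p ^ Y ℕ.* β → ¬ p ∣ α → ¬ p ∣ β → X ≡ Y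
  pow-exponent-unique zero zero _ _ _ = refl
  pow-exponent-unique (suc X) zero {α} {β} eq _ p∤β =
    ⊥-elim (p∤β (subst (p ∣_) (trans eq (ℕP.*-identityˡ β)) (p∣p^[1+X]* X α)))
  pow-exponent-unique zero (suc Y) eq p∤α p∤β = sym (pow-exponent-unique (suc Y) zero (sym eq) p∤β p∤α)
  pow-exponent-unique (suc X) (suc Y) {α} {β} eq p∤α p∤β = cong suc (pow-exponent-unique X Y
    (ℕP.*-cancelˡ-≡ _ _ p (trans (sym (ℕP.*-assoc p (p ^ X) α)) (trans eq (ℕP.*-assoc p (p ^ Y) β))))
    p∤α p∤β)

  powZ-frac : ∀ k → ℚ.toℚᵘ (powZ p pp k) ≃ frac (+ (p ^ up k)) (p ^ down k)
  powZ-frac (+ n) = toℚᵘ-/ (+ (p ^ n)) 1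
  powZ-frac -[1+ n ] = toℚᵘ-/ (+ 1) (p ^ suc n) {{p^≢0 (suc n)}}

  ord-frac : ∀ {x} v u w → x ≡ powZ p pp v ℚ.* (u ℚ./ suc w) →
    ℚ.toℚᵘ x ≃ frac (+ (p ^ up v) ℤ.* u) (p ^ down v ℕ.* suc w)
  ord-frac v u w refl = begin
    ℚ.toℚᵘ (powZ p pp v ℚ.* (u ℚ./ suc w))                      ≈⟨ ℚP.toℚᵘ-homo-* (powZ p pp v) (u ℚ./ suc w) ⟩
    ℚ.toℚᵘ (powZ p pp v) ℚᵘ.* ℚ.toℚᵘ (u ℚ./ suc w)              ≈⟨ ℚᵘP.*-cong (powZ-frac v) (toℚᵘ-/ u (suc w)) ⟩
    frac (+ (p ^ up v)) (p ^ down v) ℚᵘ.* frac u (suc w)        ≈⟨ frac-* (+ (p ^ up v)) (p ^ down v) u (suc w) {{p^≢0 (down v)}} ⟩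
    frac (+ (p ^ up v) ℤ.* u) (p ^ down v ℕ.* suc w)            ∎
    where open ℚᵘP.≃-Reasoning

  -- x ≃ p^A · n / p^B with n prime to p: n is the unit part of x, and A − B
  -- its p-adic order.
  record UnitForm (x : ℚ) (n A B : ℕ) : Set where
    constructor unitForm
    field
      p∤n : ¬ p ∣ n
      value : ℚ.toℚᵘ x ≃ frac (+ (p ^ A ℕ.* n)) (p ^ B)

  -- A nonnegative element of order v is p^v · u / w with u, w natural and
  -- prime to p: a negative u would make x negative.
  nonneg-ord-frac : ∀ {x v} → HasOrd p pp x v → 0ℚ ℚ.≤ x →
    ∃₂ λ u w → ¬ p ∣ u × ¬ p ∣ suc w × ℚ.toℚᵘ x ≃ frac (+ (p ^ up v ℕ.* u)) (p ^ down v ℕ.* suc w)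
  nonneg-ord-frac {x} {v} (+ u , w , p∤u , p∤w , x≡) _ =
    u , w , p∤u , p∤w ,
    ℚᵘP.≃-trans (ord-frac v (+ u) w x≡)
      (ℚᵘP.≃-reflexive (cong (λ i → frac i (p ^ down v ℕ.* suc w)) (sym (ℤP.pos-* (p ^ up v) u))))
  nonneg-ord-frac {x} {v} (-[1+ j ] , w , _ , _ , x≡) 0≤x =
    ⊥-elim (ℤP.<⇒≱ (negative (p ^ up v) {{p^≢0 (up v)}})
      (frac-nonneg (+ (p ^ up v) ℤ.* -[1+ j ]) (p ^ down v ℕ.* suc w) {{ℕP.m*n≢0 _ _ {{p^≢0 (down v)}}}}
        (ℚᵘP.≤-respʳ-≃ (ord-frac v -[1+ j ] w x≡) (ℚP.toℚᵘ-mono-≤ 0≤x))))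
    where
    negative : ∀ m .{{_ : NonZero m}} → + m ℤ.* -[1+ j ] ℤ.< + 0
    negative (suc m) = ℤ.-<+

  denominator-clears : ∀ {x} A B u w e m →
    ℚ.toℚᵘ x ≃ frac (+ (p ^ A ℕ.* u)) (p ^ B ℕ.* suc w) → x ℚ.* fromℤ (+ (p ^ e)) ≡ fromℤ m →
    suc w ∣ p ^ (A ℕ.+ e) ℕ.* u
  denominator-clears {x} A B u w e m x≃ x*pᵉ≡m = divides (ℤ.∣ m ∣ ℕ.* p ^ B) cleared
    where
    instance
      B≢0 : NonZero (p ^ B)
      B≢0 = p^≢0 B
    den≢0 : NonZero (p ^ B ℕ.* suc w ℕ.* 1)
    den≢0 = ℕP.m*n≢0 _ 1 {{ℕP.m*n≢0 (p ^ B) (suc w)}}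
    regroup : ∀ a b c → a ℕ.* (b ℕ.* c ℕ.* 1) ≡ a ℕ.* b ℕ.* c
    regroup = solve-∀
    cross : frac (+ (p ^ A ℕ.* u) ℤ.* + (p ^ e)) (p ^ B ℕ.* suc w ℕ.* 1) ≃ frac m 1
    cross = begin
      frac (+ (p ^ A ℕ.* u) ℤ.* + (p ^ e)) (p ^ B ℕ.* suc w ℕ.* 1)
        ≈⟨ frac-* (+ (p ^ A ℕ.* u)) (p ^ B ℕ.* suc w) (+ (p ^ e)) 1 {{ℕP.m*n≢0 (p ^ B) (suc w)}} ⟨
      frac (+ (p ^ A ℕ.* u)) (p ^ B ℕ.* suc w) ℚᵘ.* frac (+ (p ^ e)) 1
        ≈⟨ ℚᵘP.*-cong x≃ (toℚᵘ-/ (+ (p ^ e)) 1) ⟨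
      ℚ.toℚᵘ x ℚᵘ.* ℚ.toℚᵘ (fromℤ (+ (p ^ e)))  ≈⟨ ℚP.toℚᵘ-homo-* x (fromℤ (+ (p ^ e))) ⟨
      ℚ.toℚᵘ (x ℚ.* fromℤ (+ (p ^ e)))           ≈⟨ ℚP.toℚᵘ-cong x*pᵉ≡m ⟩
      ℚ.toℚᵘ (fromℤ m)                            ≈⟨ toℚᵘ-/ m 1 ⟩
      frac m 1                                    ∎
      where open ℚᵘP.≃-Reasoning

    cleared : p ^ (A ℕ.+ e) ℕ.* u ≡ ℤ.∣ m ∣ ℕ.* p ^ B ℕ.* suc w
    cleared = begin
      p ^ (A ℕ.+ e) ℕ.* u                        ≡⟨ pow-split A e u ⟩
      p ^ A ℕ.* u ℕ.* p ^ e                      ≡⟨ ℕP.*-identityʳ _ ⟨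
      p ^ A ℕ.* u ℕ.* p ^ e ℕ.* 1                ≡⟨ cong (ℕ._* 1) (ℤP.abs-* (+ (p ^ A ℕ.* u)) (+ (p ^ e))) ⟨
      ℤ.∣ + (p ^ A ℕ.* u) ℤ.* + (p ^ e) ∣ ℕ.* 1  ≡⟨ frac-≃⇒ (p ^ B ℕ.* suc w ℕ.* 1) 1 {{den≢0}} cross ⟩
      ℤ.∣ m ∣ ℕ.* (p ^ B ℕ.* suc w ℕ.* 1)        ≡⟨ regroup ℤ.∣ m ∣ (p ^ B) (suc w) ⟩
      ℤ.∣ m ∣ ℕ.* p ^ B ℕ.* suc w                ∎
      where open ≡-Reasoning

  -- Hence, w being prime to p, it divides u, and u / w is the unit part of x.
  unitForm-of-integral : ∀ {x} A B u w e m → ¬ p ∣ u → ¬ p ∣ suc w →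
    ℚ.toℚᵘ x ≃ frac (+ (p ^ A ℕ.* u)) (p ^ B ℕ.* suc w) → x ℚ.* fromℤ (+ (p ^ e)) ≡ fromℤ m →
    ∃ λ n → UnitForm x n A B
  unitForm-of-integral A B u w e m p∤u p∤w x≃ x*pᵉ≡m
    with coprime-pow-divisor (A ℕ.+ e) p∤w (denominator-clears A B u w e m x≃ x*pᵉ≡m)
  ... | divides c u≡c*w = c , unitForm p∤c
          (ℚᵘP.≃-trans x≃ (frac-≃⇐ (p ^ B ℕ.* suc w) (p ^ B) {{ℕP.m*n≢0 (p ^ B) (suc w) {{p^≢0 B}}}} {{p^≢0 B}} cancel))
    where
    p∤c : ¬ p ∣ c
    p∤c p∣c = p∤u (subst (p ∣_) (sym u≡c*w) (∣-trans p∣c (m∣m*n (suc w))))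
    regroup : ∀ a b c d → a ℕ.* (b ℕ.* c) ℕ.* d ≡ a ℕ.* b ℕ.* (d ℕ.* c)
    regroup = solve-∀
    cancel : p ^ A ℕ.* u ℕ.* p ^ B ≡ p ^ A ℕ.* c ℕ.* (p ^ B ℕ.* suc w)
    cancel = trans (cong (λ t → p ^ A ℕ.* t ℕ.* p ^ B) u≡c*w) (regroup (p ^ A) c (suc w) (p ^ B))

  unitForm-of-ord : ∀ {x v} → HasOrd p pp x v → InZ1p p x → 0ℚ ℚ.≤ x →
    ∃ λ n → UnitForm x n (up v) (down v)
  unitForm-of-ord {v = v} ord (e , m , x*pᵉ≡m) 0≤x with nonneg-ord-frac {v = v} ord 0≤x
  ... | u , w , p∤u , p∤w , x≃ = unitForm-of-integral (up v) (down v) u w e m p∤u p∤w x≃ x*pᵉ≡m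

  unitForm-scale : ∀ {x n} A B k → UnitForm x n A B →
    UnitForm (x ℚ.* powZ p pp k) n (A ℕ.+ up k) (B ℕ.+ down k)
  unitForm-scale {x} {n} A B k (unitForm p∤n x≃) = unitForm p∤n (begin
    ℚ.toℚᵘ (x ℚ.* powZ p pp k)                                    ≈⟨ ℚP.toℚᵘ-homo-* x (powZ p pp k) ⟩
    ℚ.toℚᵘ x ℚᵘ.* ℚ.toℚᵘ (powZ p pp k)                            ≈⟨ ℚᵘP.*-cong x≃ (powZ-frac k) ⟩
    frac (+ (p ^ A ℕ.* n)) (p ^ B) ℚᵘ.* frac (+ (p ^ up k)) (p ^ down k)
      ≈⟨ frac-* (+ (p ^ A ℕ.* n)) (p ^ B) (+ (p ^ up k)) (p ^ down k) {{p^≢0 B}} {{p^≢0 (down k)}} ⟩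
    frac (+ (p ^ A ℕ.* n) ℤ.* + (p ^ up k)) (p ^ B ℕ.* p ^ down k) ≡⟨ cong₂ frac numerator denominator ⟩
    frac (+ (p ^ (A ℕ.+ up k) ℕ.* n)) (p ^ (B ℕ.+ down k))        ∎)
    where
    open ℚᵘP.≃-Reasoning
    numerator : + (p ^ A ℕ.* n) ℤ.* + (p ^ up k) ≡ + (p ^ (A ℕ.+ up k) ℕ.* n)
    numerator = trans (sym (ℤP.pos-* (p ^ A ℕ.* n) (p ^ up k))) (cong +_ (sym (pow-split A (up k) n)))
    denominator : p ^ B ℕ.* p ^ down k ≡ p ^ (B ℕ.+ down k)
    denominator = sym (ℕP.^-distribˡ-+-* p B (down k))

  -- The exponent of a unit form is the p-adic order: by uniqueness of the
  -- p-exponent, a unit form of an element of order v can be rewritten with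
  -- exponents up v, down v.
  unitForm-ord : ∀ {x n v} A B → UnitForm x n A B → HasOrd p pp x v → UnitForm x n (up v) (down v)
  unitForm-ord {x} {n} {v} A B (unitForm p∤n x≃) (u , w , p∤u , p∤w , x≡) =
    unitForm p∤n (ℚᵘP.≃-trans x≃ (frac-≃⇐ (p ^ B) (p ^ down v) {{p^≢0 B}} {{p^≢0 (down v)}} shifted))
    where
    open ≡-Reasoning
    cross : p ^ A ℕ.* n ℕ.* (p ^ down v ℕ.* suc w) ≡ ℤ.∣ + (p ^ up v) ℤ.* u ∣ ℕ.* p ^ B
    cross = frac-≃⇒ (p ^ B) (p ^ down v ℕ.* suc w) {{p^≢0 B}} {{ℕP.m*n≢0 _ _ {{p^≢0 (down v)}}}}
      (ℚᵘP.≃-trans (ℚᵘP.≃-sym x≃) (ord-frac v u w x≡))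
    regroup : ∀ a b c d → a ℕ.* (b ℕ.* c) ℕ.* d ≡ a ℕ.* b ℕ.* (d ℕ.* c)
    regroup = solve-∀
    exponents : A ℕ.+ down v ≡ up v ℕ.+ B
    exponents = pow-exponent-unique (A ℕ.+ down v) (up v ℕ.+ B) (begin
      p ^ (A ℕ.+ down v) ℕ.* (n ℕ.* suc w)        ≡⟨ pow-split A (down v) (n ℕ.* suc w) ⟩
      p ^ A ℕ.* (n ℕ.* suc w) ℕ.* p ^ down v      ≡⟨ regroup (p ^ A) n (suc w) (p ^ down v) ⟩
      p ^ A ℕ.* n ℕ.* (p ^ down v ℕ.* suc w)      ≡⟨ cross ⟩
      ℤ.∣ + (p ^ up v) ℤ.* u ∣ ℕ.* p ^ B          ≡⟨ cong (ℕ._* p ^ B) (ℤP.abs-* (+ (p ^ up v)) u) ⟩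
      p ^ up v ℕ.* ℤ.∣ u ∣ ℕ.* p ^ B              ≡⟨ pow-split (up v) B ℤ.∣ u ∣ ⟨
      p ^ (up v ℕ.+ B) ℕ.* ℤ.∣ u ∣                ∎) (∤-* p∤n p∤w) p∤u
    shifted : p ^ A ℕ.* n ℕ.* p ^ down v ≡ p ^ up v ℕ.* n ℕ.* p ^ B
    shifted = begin
      p ^ A ℕ.* n ℕ.* p ^ down v  ≡⟨ pow-split A (down v) n ⟨
      p ^ (A ℕ.+ down v) ℕ.* n    ≡⟨ cong (λ e → p ^ e ℕ.* n) exponents ⟩
      p ^ (up v ℕ.+ B) ℕ.* n      ≡⟨ pow-split (up v) B n ⟩
      p ^ up v ℕ.* n ℕ.* p ^ B    ∎

  unit-decreases : ∀ {y z m n} A B A′ B′ → UnitForm y m A B → UnitForm z n A′ B′ →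
    A′ ℕ.+ B ≤ A ℕ.+ B′ → y ℚ.< z → m < n
  unit-decreases {m = m} {n} A B A′ B′ (unitForm _ y≃) (unitForm _ z≃) ord≤ y<z =
    ℕP.*-cancelˡ-< (p ^ (A′ ℕ.+ B)) m n (begin-strict
      p ^ (A′ ℕ.+ B) ℕ.* m    ≤⟨ ℕP.*-monoˡ-≤ m (ℕP.^-monoʳ-≤ p ord≤) ⟩
      p ^ (A ℕ.+ B′) ℕ.* m    ≡⟨ pow-split A B′ m ⟩
      p ^ A ℕ.* m ℕ.* p ^ B′  <⟨ cross ⟩
      p ^ A′ ℕ.* n ℕ.* p ^ B  ≡⟨ pow-split A′ B n ⟨
      p ^ (A′ ℕ.+ B) ℕ.* n    ∎)
    where
    open ℕP.≤-Reasoning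
    cross : p ^ A ℕ.* m ℕ.* p ^ B′ < p ^ A′ ℕ.* n ℕ.* p ^ B
    cross = frac-<⇒ (p ^ B) (p ^ B′) {{p^≢0 B}} {{p^≢0 B′}}
      (ℚᵘP.<-respʳ-≃ z≃ (ℚᵘP.<-respˡ-≃ y≃ (ℚP.toℚᵘ-mono-< y<z)))

  absLe-ord : ∀ {x y} → x ≢ 0ℚ → AbsLe p pp x y →
    ∃₂ λ vx vy → HasOrd p pp x vx × HasOrd p pp y vy × vy ℤ.≤ vx
  absLe-ord x≢0 (inj₁ x≡0) = ⊥-elim (x≢0 x≡0)
  absLe-ord _ (inj₂ ords) = ords

  unitForm-of-nonzero : ∀ {x y} → x ≢ 0ℚ → InZ1p p x → 0ℚ ℚ.≤ x → AbsLe p pp x y →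
    ∃ λ n → ∃₂ (UnitForm x n)
  unitForm-of-nonzero {x} {y} x≢0 x∈ 0≤x x≤y = from-orders (absLe-ord x≢0 x≤y)
    where
    from-orders : (∃₂ λ vx vy → HasOrd p pp x vx × HasOrd p pp y vy × vy ℤ.≤ vx) → ∃ λ n → ∃₂ (UnitForm x n)
    from-orders (v , _ , ord , _) = map₂ (λ form → up v , down v , form) (unitForm-of-ord {v = v} ord x∈ 0≤x)

  greedy-unit-decreases : ∀ {x y n} A B k → UnitForm x n A B →
    y ≢ 0ℚ → InZ1p p y → 0ℚ ℚ.≤ y → y ℚ.< x ℚ.* powZ p pp k → AbsLe p pp y (x ℚ.* powZ p pp k) →
    ∃ λ m → m < n × ∃₂ (UnitForm y m)
  greedy-unit-decreases {x} {y} {n} A B k x-form y≢0 y∈ 0≤y y<xpᵏ y≤xpᵏ = from-orders (absLe-ord y≢0 y≤xpᵏ)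
    where
    from-orders : (∃₂ λ vy vz → HasOrd p pp y vy × HasOrd p pp (x ℚ.* powZ p pp k) vz × vz ℤ.≤ vy) →
      ∃ λ m → m < n × ∃₂ (UnitForm y m)
    from-orders (vy , vz , ord-y , ord-z , vz≤vy) = m , m<n , up vy , down vy , y-form
      where
      y-unit : ∃ λ m → UnitForm y m (up vy) (down vy)
      y-unit = unitForm-of-ord {v = vy} ord-y y∈ 0≤y
      m : ℕ
      m = proj₁ y-unit
      y-form : UnitForm y m (up vy) (down vy)
      y-form = proj₂ y-unit
      z-form : UnitForm (x ℚ.* powZ p pp k) n (up vz) (down vz)
      z-form = unitForm-ord (A ℕ.+ up k) (B ℕ.+ down k) (unitForm-scale A B k x-form) ord-z
      m<n : m < n
      m<n = unit-decreases (up vy) (down vy) (up vz) (down vz) y-form z-form (up-down-mono vz≤vy) y<xpᵏ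

theorem4p4 : (p : ℕ) (pp : Prime p) (a b : ℤ) → + 0 ℤ.< a → b ≢ + 0 → gcd a b ≡ + 1 →
    (k v : ℤ) → HasOrd p pp (a /ℤ b) v → ℤ.- v ℤ.< k →
    (q r : ℕ → ℚ) →
    (∀ i → (∀ j → j < i → r j ≢ 0ℚ) → GreedyStep p pp k a b q r i) →
    Σ ℕ λ N → r N ≡ 0ℚ
theorem4p4 p pp a b _ _ _ k _ _ _ q r greedy =
  descent (λ i → r i ≡ 0ℚ) (λ i → r i ℚ.≟ 0ℚ) (λ i n → ∃₂ (UnitForm p pp (r i) n)) start step
  where
  start : r 0 ≢ 0ℚ → ∃ λ n → ∃₂ (UnitForm p pp (r 0) n)
  start r₀≢0 = from-step (greedy 0 (λ _ ()))
    where
    from-step : GreedyStep p pp k a b q r 0 → ∃ λ n → ∃₂ (UnitForm p pp (r 0) n)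
    from-step (_ , r₀∈ , _ , 0≤r₀ , _ , r₀≤) = unitForm-of-nonzero p pp r₀≢0 r₀∈ 0≤r₀ r₀≤

  step : ∀ i n → (∀ j → j < suc i → r j ≢ 0ℚ) → ∃₂ (UnitForm p pp (r i) n) → r (suc i) ≢ 0ℚ →
    ∃ λ m → m < n × ∃₂ (UnitForm p pp (r (suc i)) m)
  step i n nonzero (A , B , rᵢ-form) rᵢ₊₁≢0 = from-step (greedy (suc i) nonzero)
    where
    from-step : GreedyStep p pp k a b q r (suc i) → ∃ λ m → m < n × ∃₂ (UnitForm p pp (r (suc i)) m)
    from-step (_ , rᵢ₊₁∈ , _ , 0≤rᵢ₊₁ , rᵢ₊₁< , rᵢ₊₁≤) =
      greedy-unit-decreases p pp A B k rᵢ-form rᵢ₊₁≢0 rᵢ₊₁∈ 0≤rᵢ₊₁ rᵢ₊₁< rᵢ₊₁≤
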